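{- Let $G$ be a finite simple graph and $k$ a positive integer with $k\ge\chi(G)$ and $|V(G)|\ge k+1$. If the strong $k$-colour graph $S_k(G)$ is connected, then the $k$-colour graph $C_k(G)$ is also connected.
   Context: A proper $k$-colouring of $G$ is a map $V(G)\to\{1,\dots,k\}$ giving adjacent vertices different colours; it is strong if all $k$ colours appear. The $k$-colour graph $C_k(G)$ has all proper $k$-colourings of $G$ as vertices, two being adjacent iff they differ in colour on exactly one vertex. The strong $k$-colour graph $S_k(G)$ is the induced subgraph of $C_k(G)$ on the strong $k$-colourings. -}

module Defs where

open import Data.Nat using (ℕ)
open import Data.Fin using (Fin)
open import Data.Vec using (Vec; lookup)
open import Data.Empty using (⊥)
open import Data.Product using (Σ; _×_; ∃; proj₁)
open import Relation.Binary.PropositionalEquality using (_≡_; _≢_)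
open import Relation.Binary.Construct.Closure.ReflexiveTransitive using (Star)

record Graph (n : ℕ) : Set₁ where
  field
    Adj       : Fin n → Fin n → Set
    Adj-sym   : ∀ {u v} → Adj u v → Adj v u
    Adj-irrefl : ∀ {v} → Adj v v → ⊥
open Graph public

-- A k-colouring: each vertex gets a colour in Fin k (colours 1..k renamed 0..k-1).
Colouring : ℕ → ℕ → Set
Colouring n k = Vec (Fin k) n

Proper : ∀ {n k} → Graph n → Colouring n k → Set
Proper G c = ∀ u v → Adj G u v → lookup c u ≢ lookup c v

Strong : ∀ {n k} → Colouring n k → Set
Strong {n} {k} c = ∀ (i : Fin k) → ∃ λ (v : Fin n) → lookup c v ≡ i

ChromaticAtMost : ∀ {n} → Graph n → ℕ → Set
ChromaticAtMost {n} G k = Σ (Colouring n k) (Proper G)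

DifferOnOne : ∀ {n k} → Colouring n k → Colouring n k → Set
DifferOnOne {n} c d =
  ∃ λ (v : Fin n) → (lookup c v ≢ lookup d v) × (∀ w → w ≢ v → lookup c w ≡ lookup d w)

CVert : ∀ {n} → Graph n → ℕ → Set
CVert {n} G k = Σ (Colouring n k) (Proper G)

SVert : ∀ {n} → Graph n → ℕ → Set
SVert {n} G k = Σ (Colouring n k) (λ c → Proper G c × Strong c)

CEdge : ∀ {n} {G : Graph n} {k} → CVert G k → CVert G k → Set
CEdge a b = DifferOnOne (proj₁ a) (proj₁ b)

SEdge : ∀ {n} {G : Graph n} {k} → SVert G k → SVert G k → Set
SEdge a b = DifferOnOne (proj₁ a) (proj₁ b)

Connected : (V : Set) → (V → V → Set) → Set
Connected V E = ∀ (a b : V) → Star E a b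

C-Connected : ∀ {n} → Graph n → ℕ → Set
C-Connected G k = Connected (CVert G k) (CEdge {G = G} {k})

S-Connected : ∀ {n} → Graph n → ℕ → Set
S-Connected G k = Connected (SVert G k) (SEdge {G = G} {k})

-- Every proper k-colouring is joined in C_k(G) to a strong one, so any two proper colourings
-- are joined through S_k(G). To reach a strong colouring, add the missing colours 0, 1, …, k−1
-- one at a time: if colour J is missing, the n ≥ k vertices carry at most k − 1 colours, so by
-- pigeonhole two distinct vertices v, w share a colour. Recolouring v with J is a single step in
-- C_k(G); it stays proper because J was unused, and it loses no colour because w keeps the old one.
module Submission where

open import Defs
open import Data.Nat using (ℕ; zero; suc; _≤_; _≥_; _<_)
open import Data.Nat.Properties using (≤-refl; <⇒≤; m<1+n⇒m<n∨m≡n)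
open import Data.Fin using (Fin; toℕ; fromℕ<; punchOut; _≟_)
open import Data.Fin.Properties
  using (pigeonhole; punchOut-injective; toℕ-injective; toℕ<n; toℕ-fromℕ<; any?; <-irrefl)
open import Data.Vec using (lookup; _[_]≔_)
open import Data.Vec.Properties using (lookup∘update; lookup∘update′)
open import Data.Product using (Σ; _×_; ∃; ∃₂; proj₁; _,_)
open import Data.Sum using (inj₁; inj₂)
open import Data.Empty using (⊥-elim)
open import Relation.Nullary using (¬_; yes; no)
open import Relation.Binary.PropositionalEquality using (_≡_; _≢_; refl; sym; trans; subst)
open import Relation.Binary.Construct.Closure.ReflexiveTransitive
  using (Star; ε; _◅_; _◅◅_; gmap; reverse)

Used : ∀ {n k} → Colouring n k → Fin k → Set
Used {n} c i = ∃ λ (v : Fin n) → lookup c v ≡ i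

UsedBelow : ∀ {n k} → ℕ → Colouring n k → Set
UsedBelow j c = ∀ i → toℕ i < j → Used c i

usedBelow-suc : ∀ {n k} {j : ℕ} (c : Colouring n k) (j<k : j < k) →
                UsedBelow j c → Used c (fromℕ< j<k) → UsedBelow (suc j) c
usedBelow-suc c j<k below used i i<1+j with m<1+n⇒m<n∨m≡n i<1+j
... | inj₁ i<j = below i i<j
... | inj₂ i≡j = subst (Used c) (toℕ-injective (trans (toℕ-fromℕ< j<k) (sym i≡j))) used

usedBelow⇒strong : ∀ {n k} (c : Colouring n k) → UsedBelow k c → Strong c
usedBelow⇒strong c below i = below i (toℕ<n i)

DifferOnOne-sym : ∀ {n k} {c d : Colouring n k} → DifferOnOne c d → DifferOnOne d c
DifferOnOne-sym (v , c≢d , rest) = v , (λ e → c≢d (sym e)) , (λ w w≢v → sym (rest w w≢v))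

missing-colour⇒repeat : ∀ {n k} → k ≤ n → (c : Colouring n k) (J : Fin k) → ¬ Used c J →
                        ∃₂ λ v w → v ≢ w × lookup c v ≡ lookup c w
missing-colour⇒repeat {k = suc k} k≤n c J unused =
  let v , w , v<w , same = pigeonhole k≤n (λ u → punchOut (avoids u))
  in v , w , (λ v≡w → <-irrefl v≡w v<w) , punchOut-injective (avoids v) (avoids w) same
  where avoids : ∀ u → J ≢ lookup c u
        avoids u J≡cu = unused (u , sym J≡cu)

recolour-step : ∀ {n k} (c : Colouring n k) (v : Fin n) (J : Fin k) →
                lookup c v ≢ J → DifferOnOne c (c [ v ]≔ J)
recolour-step c v J cv≢J =
  v , (λ e → cv≢J (trans e (lookup∘update v c J))) , (λ w w≢v → sym (lookup∘update′ w≢v c J))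

recolour-proper : ∀ {n k} (G : Graph n) (c : Colouring n k) (v : Fin n) (J : Fin k) →
                  Proper G c → ¬ Used c J → Proper G (c [ v ]≔ J)
recolour-proper G c v J proper unused x y adj with x ≟ v | y ≟ v
... | yes refl | yes refl = ⊥-elim (Adj-irrefl G adj)
... | yes refl | no y≢v = λ e →
  unused (y , trans (sym (lookup∘update′ y≢v c J)) (trans (sym e) (lookup∘update v c J)))
... | no x≢v | yes refl = λ e →
  unused (x , trans (sym (lookup∘update′ x≢v c J)) (trans e (lookup∘update v c J)))
... | no x≢v | no y≢v = λ e →
  proper x y adj (trans (sym (lookup∘update′ x≢v c J)) (trans e (lookup∘update′ y≢v c J)))

recolour-keepsUsed : ∀ {n k} (c : Colouring n k) {v w : Fin n} (J : Fin k) →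
                     v ≢ w → lookup c v ≡ lookup c w → ∀ i → Used c i → Used (c [ v ]≔ J) i
recolour-keepsUsed c {v} {w} J v≢w cv≡cw i (u , cu≡i) with u ≟ v
... | yes refl = w , trans (lookup∘update′ (λ w≡v → v≢w (sym w≡v)) c J) (trans (sym cv≡cw) cu≡i)
... | no u≢v   = u , trans (lookup∘update′ u≢v c J) cu≡i

CWalk : ∀ {n} (G : Graph n) (k : ℕ) → CVert G k → CVert G k → Set
CWalk G k = Star (CEdge {G = G} {k})

use-next-colour : ∀ {n k} (G : Graph n) → k ≤ n → {j : ℕ} (j<k : j < k) (a : CVert G k) →
                  UsedBelow j (proj₁ a) →
                  Σ (CVert G k) λ b → CWalk G k a b × UsedBelow (suc j) (proj₁ b)
use-next-colour G k≤n j<k (c , proper) below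
  with any? (λ v → lookup c v ≟ fromℕ< j<k)
... | yes used = (c , proper) , ε , usedBelow-suc c j<k below used
... | no unused with missing-colour⇒repeat k≤n c (fromℕ< j<k) unused
...   | v , w , v≢w , cv≡cw =
  (c′ , recolour-proper G c v J proper unused) ,
  recolour-step c v J (λ cv≡J → unused (v , cv≡J)) ◅ ε ,
  usedBelow-suc c′ j<k (λ i i<j → recolour-keepsUsed c J v≢w cv≡cw i (below i i<j))
                       (v , lookup∘update v c J)
  where J = fromℕ< j<k
        c′ = c [ v ]≔ J

reach-usedBelow : ∀ {n k} (G : Graph n) → k ≤ n → (j : ℕ) → j ≤ k → (a : CVert G k) →
                  Σ (CVert G k) λ b → CWalk G k a b × UsedBelow j (proj₁ b)
reach-usedBelow G k≤n zero    _   a = a , ε , λ _ ()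
reach-usedBelow G k≤n (suc j) j<k a with reach-usedBelow G k≤n j (<⇒≤ j<k) a
... | b , a⇝b , below with use-next-colour G k≤n j<k b below
...   | b′ , b⇝b′ , below′ = b′ , a⇝b ◅◅ b⇝b′ , below′

forget-strong : ∀ {n k} {G : Graph n} → SVert G k → CVert G k
forget-strong (c , proper , _) = c , proper

reach-strong : ∀ {n k} (G : Graph n) → k ≤ n → (a : CVert G k) →
               Σ (SVert G k) λ s → CWalk G k a (forget-strong {G = G} s)
reach-strong {k = k} G k≤n a with reach-usedBelow G k≤n k ≤-refl a
... | (c , proper) , a⇝c , below = (c , proper , usedBelow⇒strong c below) , a⇝c

lemma2p4 : (n k : ℕ) (G : Graph n) → 1 ≤ k → ChromaticAtMost G k → n ≥ suc k →
           S-Connected G k → C-Connected G k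
lemma2p4 n k G _ _ n>k S-connected a b
  with reach-strong G (<⇒≤ n>k) a | reach-strong G (<⇒≤ n>k) b
... | sa , a⇝sa | sb , b⇝sb =
  a⇝sa ◅◅ gmap (forget-strong {G = G}) (λ {s} {t} e → e) (S-connected sa sb)
        ◅◅ reverse (λ {c} {d} → DifferOnOne-sym {c = proj₁ c} {d = proj₁ d}) b⇝sb
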